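{- For any integer $k \geq 2$ and any positive integer $s$, there exists a (finite, simple) graph $G$ such that \[\chi_l(G^k) \ge \frac{10}{9} \cdot 3^{3sk-1} - 1 \ge 3^{3sk-1} = \chi(G^k).\]
   Context: For a graph $G$ and positive integer $k$, the $k$th power $G^k$ is the graph on $V(G)$ in which two distinct vertices $u,v$ are adjacent iff their distance in $G$ is at most $k$. $\chi(H)$ denotes the chromatic number of $H$ and $\chi_l(H)$ its list chromatic number (the least $t$ such that for every assignment of lists $L(v)$ with $|L(v)|\ge t$ there is a proper coloring $\phi$ with $\phi(v)\in L(v)$ for all $v$). -}

module Defs where

open import Data.Nat using (ℕ; zero; suc; _≤_)
open import Data.Fin using (Fin)
open import Data.List using (List; length)
open import Data.List.Membership.Propositional using (_∈_)
open import Data.List.Relation.Unary.Unique.Propositional using (Unique)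
open import Data.Product using (Σ; ∃; _×_)
open import Relation.Nullary using (¬_)
open import Relation.Binary.PropositionalEquality using (_≡_; _≢_)

record Graph : Set₁ where
  field
    n      : ℕ
    Adj    : Fin n → Fin n → Set
    sym    : ∀ {u v} → Adj u v → Adj v u
    irrefl : ∀ {u} → ¬ Adj u u

open Graph public

data Walk (G : Graph) : ℕ → Fin (n G) → Fin (n G) → Set where
  here : ∀ {u} → Walk G zero u u
  step : ∀ {m u w v} → Adj G u w → Walk G m w v → Walk G (suc m) u v

DistLe : (G : Graph) → ℕ → Fin (n G) → Fin (n G) → Set
DistLe G k u v = ∃ λ m → m ≤ k × Walk G m u v

PowAdj : (G : Graph) → ℕ → Fin (n G) → Fin (n G) → Set
PowAdj G k u v = u ≢ v × DistLe G k u v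

Proper : ∀ {N} {C : Set} → (Fin N → Fin N → Set) → (Fin N → C) → Set
Proper {N} R c = ∀ (u v : Fin N) → R u v → c u ≢ c v

Colorable : ∀ {N} → (Fin N → Fin N → Set) → ℕ → Set
Colorable {N} R t = Σ (Fin N → Fin t) λ c → Proper R c

ChromaticNumberIs : ∀ {N} → (Fin N → Fin N → Set) → ℕ → Set
ChromaticNumberIs R t = Colorable R t × (∀ t' → Colorable R t' → t ≤ t')

Choosable : ∀ {N} → (Fin N → Fin N → Set) → ℕ → Set
Choosable {N} R t =
  (L : Fin N → List ℕ) →
  (∀ v → Unique (L v) × t ≤ length (L v)) →
  Σ (Fin N → ℕ) λ φ → (∀ v → φ v ∈ L v) × Proper R φ

module Submission where

-- Let R = kh, ρ = R² + R + 1 and let H be the Cayley graph of ℤ/ρ × ℤ/3 whose steps are the images of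
-- the hexagon of radius h of the triangular lattice ℤ² under P ↦ (φ P mod ρ, ψ P mod 3), where
-- φ(x, y) = x - Ry and ψ is a suitable second linear form. A walk of length ≤ k in H realises a
-- displacement from the hexagon of radius R, on which φ is injective modulo ρ; so the ℤ/ρ-coordinate
-- is a proper colouring of H^k. Conversely the sectors of that hexagon reach every (d, δ) with d ≢ 0,
-- so H^k contains the complete ρ-partite graph with parts of size 3, whose choice number exceeds
-- 4ρ/3 - 1. Taking G = H ⊎ K_N with N = 3^(3sk-1) and h such that 5N/6 ≤ ρ ≤ N gives χ(G^k) = N and
-- χ_l(G^k) ≥ 10N/9 - 1.

open import Data.Nat.Base using (ℕ; NonZero)
open import Data.Integer.Base using (ℤ)

module ModularIntegers where
  open import Data.Nat.Base as ℕ using (ℕ; NonZero; zero; suc; _<_)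
  import Data.Nat.Properties as ℕ
  import Data.Nat.Divisibility as ℕ
  open import Data.Integer.Base using (ℤ; +_; _+_; _-_; -_; _*_; ∣_∣; 0ℤ; -1ℤ)
  open import Data.Integer.Properties
    using (+-inverseʳ; +-identityʳ; +-identityˡ; -1*i≡-i; ∣i∣≡0⇒i≡0; m-n≡m⊖n; ∣m⊝n∣≤m⊔n; +-injective)
  open import Data.Integer.Divisibility.Signed using (_∣_; divides; ∣m⇒∣-m; ∣m∣n⇒∣m+n; ∣⇒∣ᵤ)
  open import Data.Integer.DivMod using (_%ℕ_; _/ℕ_; a≡a%ℕn+[a/ℕn]*n)
  open import Data.Integer.Tactic.RingSolver using (solve-∀)
  open import Relation.Binary.PropositionalEquality
  open import Relation.Nullary using (contradiction)

  infix 4 _≡_[mod_]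
  record _≡_[mod_] (x y : ℤ) (m : ℕ) : Set where
    constructor ≡-mod
    field m∣x-y : + m ∣ x - y

  private variable
    m : ℕ
    x y z u v : ℤ

  ≡-mod-reflexive : x ≡ y → x ≡ y [mod m ]
  ≡-mod-reflexive {x = x} refl = ≡-mod (divides 0ℤ (+-inverseʳ x))

  ≡-mod-resp : ∀ {x′ y′} → x ≡ x′ → y ≡ y′ → x ≡ y [mod m ] → x′ ≡ y′ [mod m ]
  ≡-mod-resp refl refl x≡y = x≡y

  ≡-mod-sym : x ≡ y [mod m ] → y ≡ x [mod m ]
  ≡-mod-sym {x = x} {y = y} (≡-mod m∣x-y) = ≡-mod (subst (_ ∣_) (negate x y) (∣m⇒∣-m m∣x-y))
    where
    negate : ∀ x y → - (x - y) ≡ y - x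
    negate = solve-∀

  ≡-mod-trans : x ≡ y [mod m ] → y ≡ z [mod m ] → x ≡ z [mod m ]
  ≡-mod-trans {x = x} {y = y} {z = z} (≡-mod m∣x-y) (≡-mod m∣y-z) =
    ≡-mod (subst (_ ∣_) (telescope x y z) (∣m∣n⇒∣m+n m∣x-y m∣y-z))
    where
    telescope : ∀ x y z → (x - y) + (y - z) ≡ x - z
    telescope = solve-∀

  +-cong-mod : x ≡ y [mod m ] → u ≡ v [mod m ] → x + u ≡ y + v [mod m ]
  +-cong-mod {x = x} {y = y} {u = u} {v = v} (≡-mod m∣x-y) (≡-mod m∣u-v) =
    ≡-mod (subst (_ ∣_) (regroup x y u v) (∣m∣n⇒∣m+n m∣x-y m∣u-v))
    where
    regroup : ∀ x y u v → (x - y) + (u - v) ≡ (x + u) - (y + v)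
    regroup = solve-∀

  -‿cong-mod : x ≡ y [mod m ] → - x ≡ - y [mod m ]
  -‿cong-mod {x = x} {y = y} (≡-mod m∣x-y) = ≡-mod (subst (_ ∣_) (negate x y) (∣m⇒∣-m m∣x-y))
    where
    negate : ∀ x y → - (x - y) ≡ - x - - y
    negate = solve-∀

  x-y≡0⇒x≡y : x - y ≡ 0ℤ [mod m ] → x ≡ y [mod m ]
  x-y≡0⇒x≡y {x = x} {y = y} x-y≡0 =
    ≡-mod-resp (cancel x y) (+-identityˡ y) (+-cong-mod x-y≡0 (≡-mod-reflexive {x = y} refl))
    where
    cancel : ∀ x y → (x - y) + y ≡ x
    cancel = solve-∀

  -m≡0-mod : ∀ m → - + m ≡ 0ℤ [mod m ]
  -m≡0-mod m = ≡-mod (divides -1ℤ (trans (+-identityʳ (- + m)) (sym (-1*i≡-i (+ m)))))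

  ≡-mod-%ℕ : ∀ x m .{{_ : NonZero m}} → x ≡ + (x %ℕ m) [mod m ]
  ≡-mod-%ℕ x m = ≡-mod (divides (x /ℕ m) (subst (λ w → w - + (x %ℕ m) ≡ (x /ℕ m) * + m)
    (sym (a≡a%ℕn+[a/ℕn]*n x m)) (cancel (+ (x %ℕ m)) ((x /ℕ m) * + m))))
    where
    cancel : ∀ r q → (r + q) - r ≡ q
    cancel = solve-∀

  ∣z∣<m∧m∣z⇒z≡0 : ∣ z ∣ < m → + m ∣ z → z ≡ 0ℤ
  ∣z∣<m∧m∣z⇒z≡0 {z = z} ∣z∣<m m∣z with ∣ z ∣ in ∣z∣≡
  ... | zero  = ∣i∣≡0⇒i≡0 ∣z∣≡
  ... | suc n = contradiction (subst (_ ℕ.∣_) ∣z∣≡ (∣⇒∣ᵤ m∣z)) (ℕ.>⇒∤ ∣z∣<m)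

  ≡0-mod⇒≡0 : ∣ z ∣ < m → z ≡ 0ℤ [mod m ] → z ≡ 0ℤ
  ≡0-mod⇒≡0 {z = z} ∣z∣<m (≡-mod m∣z-0) = ∣z∣<m∧m∣z⇒z≡0 ∣z∣<m (subst (_ ∣_) (+-identityʳ z) m∣z-0)

  ≡-mod⇒≡ : ∀ {i j} → i < m → j < m → + i ≡ + j [mod m ] → i ≡ j
  ≡-mod⇒≡ {m} {i} {j} i<m j<m (≡-mod m∣i-j) = +-injective (begin
    + i               ≡⟨ split (+ i) (+ j) ⟩
    (+ i - + j) + + j ≡⟨ cong (_+ + j) (∣z∣<m∧m∣z⇒z≡0 ∣i-j∣<m m∣i-j) ⟩
    + j               ∎)
    where
    open ≡-Reasoning
    split : ∀ x y → x ≡ (x - y) + y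
    split = solve-∀
    ∣i-j∣<m : ∣ + i - + j ∣ < m
    ∣i-j∣<m = ℕ.≤-<-trans (ℕ.≤-reflexive (cong ∣_∣ (m-n≡m⊖n i j)))
                (ℕ.≤-<-trans (∣m⊝n∣≤m⊔n i j) (ℕ.⊔-lub i<m j<m))

module TriangularLattice where
  open import Data.Nat.Base as ℕ using (ℕ; zero; suc; _≤_; z≤n)
  import Data.Nat.Properties as ℕ
  open import Data.Integer.Base using (ℤ; +_; _+_; -_; _*_; ∣_∣; 0ℤ)
  open import Data.Integer.Properties using (∣i+j∣≤∣i∣+∣j∣; ∣-i∣≡∣i∣; abs-*; pos-+; +-comm)
  open import Data.Integer.Tactic.RingSolver using (solve-∀)
  open import Data.Product using (Σ; _×_; _,_)
  open import Data.Sum using (inj₁; inj₂)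
  open import Relation.Binary.PropositionalEquality

  Pt : Set
  Pt = ℤ × ℤ

  O : Pt
  O = 0ℤ , 0ℤ

  infixl 6 _⊕_
  _⊕_ : Pt → Pt → Pt
  (x , y) ⊕ (x′ , y′) = x + x′ , y + y′

  ⊖_ : Pt → Pt
  ⊖ (x , y) = - x , - y

  infixl 7 _⊛_
  _⊛_ : ℤ → Pt → Pt
  a ⊛ (x , y) = a * x , a * y

  lin : ℤ → ℤ → Pt → ℤ
  lin a b (x , y) = a * x + b * y

  lin-O : ∀ a b → lin a b O ≡ 0ℤ
  lin-O a b = ring a b
    where
    ring : ∀ a b → a * 0ℤ + b * 0ℤ ≡ 0ℤ
    ring = solve-∀

  lin-⊕ : ∀ a b P Q → lin a b (P ⊕ Q) ≡ lin a b P + lin a b Q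
  lin-⊕ a b (x , y) (x′ , y′) = ring a b x y x′ y′
    where
    ring : ∀ a b x y x′ y′ → a * (x + x′) + b * (y + y′) ≡ (a * x + b * y) + (a * x′ + b * y′)
    ring = solve-∀

  lin-⊖ : ∀ a b P → lin a b (⊖ P) ≡ - lin a b P
  lin-⊖ a b (x , y) = ring a b x y
    where
    ring : ∀ a b x y → a * (- x) + b * (- y) ≡ - (a * x + b * y)
    ring = solve-∀

  -- The hexagon of radius m of the triangular lattice, whose unit vectors are ±(1,0), ±(0,1), ±(1,-1).
  infix 4 _∈⬡_
  _∈⬡_ : Pt → ℕ → Set
  (x , y) ∈⬡ m = ∣ x ∣ ≤ m × ∣ y ∣ ≤ m × ∣ x + y ∣ ≤ m

  ∈⬡-mono : ∀ P {m m′} → m ≤ m′ → P ∈⬡ m → P ∈⬡ m′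
  ∈⬡-mono P m≤m′ (x≤ , y≤ , x+y≤) = ℕ.≤-trans x≤ m≤m′ , ℕ.≤-trans y≤ m≤m′ , ℕ.≤-trans x+y≤ m≤m′

  O∈⬡ : ∀ m → O ∈⬡ m
  O∈⬡ m = z≤n , z≤n , z≤n

  ⊖-∈⬡ : ∀ P {m} → P ∈⬡ m → ⊖ P ∈⬡ m
  ⊖-∈⬡ (x , y) (x≤ , y≤ , x+y≤) =
    subst (_≤ _) (sym (∣-i∣≡∣i∣ x)) x≤ ,
    subst (_≤ _) (sym (∣-i∣≡∣i∣ y)) y≤ ,
    subst (_≤ _) (trans (sym (∣-i∣≡∣i∣ (x + y))) (cong ∣_∣ (negate x y))) x+y≤
    where
    negate : ∀ x y → - (x + y) ≡ - x + - y
    negate = solve-∀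

  ⊕-∈⬡ : ∀ P Q {a b} → P ∈⬡ a → Q ∈⬡ b → P ⊕ Q ∈⬡ a ℕ.+ b
  ⊕-∈⬡ (x , y) (x′ , y′) (x≤ , y≤ , x+y≤) (x′≤ , y′≤ , x′+y′≤) =
    triangle x x′ x≤ x′≤ ,
    triangle y y′ y≤ y′≤ ,
    subst (_≤ _) (cong ∣_∣ (regroup x y x′ y′)) (triangle (x + y) (x′ + y′) x+y≤ x′+y′≤)
    where
    triangle : ∀ z z′ {a b} → ∣ z ∣ ≤ a → ∣ z′ ∣ ≤ b → ∣ z + z′ ∣ ≤ a ℕ.+ b
    triangle z z′ z≤ z′≤ = ℕ.≤-trans (∣i+j∣≤∣i∣+∣j∣ z z′) (ℕ.+-mono-≤ z≤ z′≤)
    regroup : ∀ x y x′ y′ → (x + y) + (x′ + y′) ≡ (x + x′) + (y + y′)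
    regroup = solve-∀

  -- αa + βb = α(a + b) + (β - α)b
  ∣αa+βb∣≤β : ∀ {a b} α β → ∣ b ∣ ≤ 1 → ∣ a + b ∣ ≤ 1 → α ≤ β → ∣ + α * a + + β * b ∣ ≤ β
  ∣αa+βb∣≤β {a} {b} α β b≤1 a+b≤1 α≤β = begin
    ∣ + α * a + + β * b ∣                         ≡⟨ cong ∣_∣ split ⟩
    ∣ + α * (a + b) + + (β ℕ.∸ α) * b ∣           ≤⟨ ∣i+j∣≤∣i∣+∣j∣ (+ α * (a + b)) (+ (β ℕ.∸ α) * b) ⟩
    ∣ + α * (a + b) ∣ ℕ.+ ∣ + (β ℕ.∸ α) * b ∣     ≡⟨ cong₂ ℕ._+_ (abs-* (+ α) (a + b)) (abs-* (+ (β ℕ.∸ α)) b) ⟩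
    α ℕ.* ∣ a + b ∣ ℕ.+ (β ℕ.∸ α) ℕ.* ∣ b ∣        ≤⟨ ℕ.+-mono-≤ (ℕ.*-monoʳ-≤ α a+b≤1) (ℕ.*-monoʳ-≤ (β ℕ.∸ α) b≤1) ⟩
    α ℕ.* 1 ℕ.+ (β ℕ.∸ α) ℕ.* 1                   ≡⟨ cong₂ ℕ._+_ (ℕ.*-identityʳ α) (ℕ.*-identityʳ (β ℕ.∸ α)) ⟩
    α ℕ.+ (β ℕ.∸ α)                               ≡⟨ ℕ.m+[n∸m]≡n α≤β ⟩
    β                                             ∎
    where
    open ℕ.≤-Reasoning
    regroup : ∀ A B a b → A * a + (A + B) * b ≡ A * (a + b) + B * b
    regroup = solve-∀
    split : + α * a + + β * b ≡ + α * (a + b) + + (β ℕ.∸ α) * b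
    split = trans (cong (λ w → + α * a + w * b) (trans (cong +_ (sym (ℕ.m+[n∸m]≡n α≤β))) (pos-+ α (β ℕ.∸ α))))
                  (regroup (+ α) (+ (β ℕ.∸ α)) a b)

  ∣αa+βb∣≤ : ∀ {a b m} α β → ∣ a ∣ ≤ 1 → ∣ b ∣ ≤ 1 → ∣ a + b ∣ ≤ 1 → α ≤ m → β ≤ m →
             ∣ + α * a + + β * b ∣ ≤ m
  ∣αa+βb∣≤ {a} {b} α β a≤1 b≤1 a+b≤1 α≤m β≤m with ℕ.≤-total α β
  ... | inj₁ α≤β = ℕ.≤-trans (∣αa+βb∣≤β α β b≤1 a+b≤1 α≤β) β≤m
  ... | inj₂ β≤α = ℕ.≤-trans (subst (_≤ α) (cong ∣_∣ (+-comm (+ β * b) (+ α * a)))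
                     (∣αa+βb∣≤β β α a≤1 (subst (λ w → ∣ w ∣ ≤ 1) (+-comm a b) a+b≤1) β≤α)) α≤m

  -- Two unit vectors at an angle of 120°; the points αu + βv with α, β ≥ 0 form one of the six sectors.
  record Sector : Set where
    constructor sector
    field
      u v   : Pt
      u∈⬡   : u ∈⬡ 1
      v∈⬡   : v ∈⬡ 1
      u⊕v∈⬡ : u ⊕ v ∈⬡ 1

  point : Sector → ℕ → ℕ → Pt
  point S α β = (+ α) ⊛ Sector.u S ⊕ (+ β) ⊛ Sector.v S

  point-∈⬡ : ∀ S {α β m} → α ≤ m → β ≤ m → point S α β ∈⬡ m
  point-∈⬡ (sector (a , a′) (b , b′) (a≤ , a′≤ , a+a′≤) (b≤ , b′≤ , b+b′≤) (a+b≤ , a′+b′≤ , Σ≤))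
    {α} {β} α≤m β≤m =
    ∣αa+βb∣≤ α β a≤ b≤ a+b≤ α≤m β≤m ,
    ∣αa+βb∣≤ α β a′≤ b′≤ a′+b′≤ α≤m β≤m ,
    subst (λ w → ∣ w ∣ ≤ _) (distrib (+ α) (+ β) a a′ b b′)
      (∣αa+βb∣≤ α β a+a′≤ b+b′≤ (subst (λ w → ∣ w ∣ ≤ 1) (swap a a′ b b′) Σ≤) α≤m β≤m)
    where
    distrib : ∀ p q a a′ b b′ → p * (a + a′) + q * (b + b′) ≡ (p * a + q * b) + (p * a′ + q * b′)
    distrib = solve-∀
    swap : ∀ a a′ b b′ → (a + b) + (a′ + b′) ≡ (a + a′) + (b + b′)
    swap = solve-∀

  point-≡ : ∀ S {α β a b} → + α ≡ a → + β ≡ b → point S α β ≡ a ⊛ Sector.u S ⊕ b ⊛ Sector.v S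
  point-≡ S refl refl = refl

  point-+ : ∀ S α β α′ β′ → point S (α ℕ.+ α′) (β ℕ.+ β′) ≡ point S α β ⊕ point S α′ β′
  point-+ (sector (a , a′) (b , b′) _ _ _) α β α′ β′ = cong₂ _,_ (component a b) (component a′ b′)
    where
    distrib : ∀ p p′ q q′ a b → (p + p′) * a + (q + q′) * b ≡ (p * a + q * b) + (p′ * a + q′ * b)
    distrib = solve-∀
    component : ∀ a b → + (α ℕ.+ α′) * a + + (β ℕ.+ β′) * b ≡ (+ α * a + + β * b) + (+ α′ * a + + β′ * b)
    component a b rewrite pos-+ α α′ | pos-+ β β′ = distrib (+ α) (+ α′) (+ β) (+ β′) a b

  record Conic (m : ℕ) (P : Pt) : Set where
    constructor conic
    field
      S      : Sector
      α β    : ℕ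
      α≤m    : α ≤ m
      β≤m    : β ≤ m
      point≡ : point S α β ≡ P

  data Sum⬡ (h : ℕ) : ℕ → Pt → Set where
    []  : Sum⬡ h 0 O
    _∷_ : ∀ {j Q P} → Q ∈⬡ h → Sum⬡ h j P → Sum⬡ h (suc j) (Q ⊕ P)

  split-≤ : ∀ {α} h n → α ≤ h ℕ.+ n → Σ ℕ λ α₀ → Σ ℕ λ α₁ → α₀ ≤ h × α₁ ≤ n × α ≡ α₀ ℕ.+ α₁
  split-≤ {α} h n α≤h+n with ℕ.≤-total α h
  ... | inj₁ α≤h = α , 0 , α≤h , z≤n , sym (ℕ.+-identityʳ α)
  ... | inj₂ h≤α = h , α ℕ.∸ h , ℕ.≤-refl , ℕ.m≤n+o⇒m∸n≤o α h α≤h+n , sym (ℕ.m+[n∸m]≡n h≤α)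

  point-Sum⬡ : ∀ S j {h α β} → α ≤ j ℕ.* h → β ≤ j ℕ.* h → Sum⬡ h j (point S α β)
  point-Sum⬡ S zero α≤0 β≤0 with ℕ.n≤0⇒n≡0 α≤0 | ℕ.n≤0⇒n≡0 β≤0
  ... | refl | refl = []
  point-Sum⬡ S (suc j) {h} α≤ β≤ with split-≤ h (j ℕ.* h) α≤ | split-≤ h (j ℕ.* h) β≤
  ... | α₀ , α₁ , α₀≤h , α₁≤ , refl | β₀ , β₁ , β₀≤h , β₁≤ , refl =
    subst (Sum⬡ h (suc j)) (sym (point-+ S α₀ β₀ α₁ β₁))
      (_∷_ {Q = point S α₀ β₀} (point-∈⬡ S α₀≤h β₀≤h) (point-Sum⬡ S j α₁≤ β₁≤))

  conic⇒Sum⬡ : ∀ j {h P} → Conic (j ℕ.* h) P → Sum⬡ h j P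
  conic⇒Sum⬡ j (conic S α β α≤ β≤ refl) = point-Sum⬡ S j α≤ β≤

module Displacement (m : ℕ) (a b : ℤ) where
  open import Data.Nat.Base using (ℕ; NonZero)
  open import Data.Integer.Base using (ℤ; +_; _+_; _-_; -_; 0ℤ)
  open import Data.Integer.Properties using (+-inverseʳ; +-identityʳ)
  open import Data.Integer.DivMod using (_%ℕ_)
  open import Data.Integer.Tactic.RingSolver using (solve-∀)
  open import Relation.Binary.PropositionalEquality
  open ModularIntegers
  open TriangularLattice

  infix 4 _∼[_]_
  record _∼[_]_ (x : ℤ) (P : Pt) (y : ℤ) : Set where
    constructor ∼-mod
    field lin≡ : lin a b P ≡ y - x [mod m ]

  ∼-refl : ∀ x → x ∼[ O ] x
  ∼-refl x = ∼-mod (≡-mod-reflexive (trans (lin-O a b) (sym (+-inverseʳ x))))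

  ∼-⊕ : ∀ {x y z} P Q → x ∼[ P ] y → y ∼[ Q ] z → x ∼[ P ⊕ Q ] z
  ∼-⊕ {x} {y} {z} P Q (∼-mod P∼) (∼-mod Q∼) =
    ∼-mod (≡-mod-resp (sym (lin-⊕ a b P Q)) (telescope x y z) (+-cong-mod P∼ Q∼))
    where
    telescope : ∀ x y z → (y - x) + (z - y) ≡ z - x
    telescope = solve-∀

  ∼-⊖ : ∀ {x y} P → x ∼[ P ] y → y ∼[ ⊖ P ] x
  ∼-⊖ {x} {y} P (∼-mod P∼) = ∼-mod (≡-mod-resp (sym (lin-⊖ a b P)) (negate x y) (-‿cong-mod P∼))
    where
    negate : ∀ x y → - (y - x) ≡ x - y
    negate = solve-∀

  ∼-cancel : ∀ {x y z} P Q → x ∼[ P ⊕ Q ] z → x ∼[ P ] y → y ∼[ Q ] z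
  ∼-cancel {x} {y} {z} P Q (∼-mod PQ∼) (∼-mod P∼) = ∼-mod
    (≡-mod-resp (trans (cong (_- lin a b P) (lin-⊕ a b P Q)) (cancel (lin a b P) (lin a b Q))) (telescope x y z)
      (+-cong-mod PQ∼ (-‿cong-mod P∼)))
    where
    cancel : ∀ p q → (p + q) - p ≡ q
    cancel = solve-∀
    telescope : ∀ x y z → (z - x) - (y - x) ≡ z - y
    telescope = solve-∀

  ∼-O⇒≡-mod : ∀ {x y} → x ∼[ O ] y → x ≡ y [mod m ]
  ∼-O⇒≡-mod {x} {y} (∼-mod O∼) =
    ≡-mod-resp (trans (cong (_+_ x) (lin-O a b)) (+-identityʳ x)) (cancel x y)
      (+-cong-mod (≡-mod-reflexive {x = x} refl) O∼)
    where
    cancel : ∀ x y → x + (y - x) ≡ y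
    cancel = solve-∀

  ∼-self : ∀ {x} P → x ∼[ P ] x → lin a b P ≡ 0ℤ [mod m ]
  ∼-self {x} P (∼-mod P∼) = ≡-mod-resp refl (+-inverseʳ x) P∼

  ∼-%ℕ : ∀ x P .{{_ : NonZero m}} → x ∼[ P ] + ((x + lin a b P) %ℕ m)
  ∼-%ℕ x P = ∼-mod (≡-mod-resp (cancel x (lin a b P)) refl
    (+-cong-mod (≡-mod-%ℕ (x + lin a b P) m) (≡-mod-reflexive {x = - x} refl)))
    where
    cancel : ∀ x p → (x + p) + - x ≡ p
    cancel = solve-∀

-- The Cayley graph of ℤ/p × ℤ/q whose steps are the images of the points of the hexagon of radius h
-- under P ↦ (lin a b P, lin c d P).
module CayleyGraph (p q : ℕ) .{{_ : NonZero p}} .{{_ : NonZero q}} (a b c d : ℤ) where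
  open import Defs hiding (sym)
  open import Data.Nat.Base using (suc; _*_; z≤n; s≤s)
  open import Data.Nat.Properties using (m≤n⇒m≤1+n)
  open import Data.Integer.Base using (+_; _+_; _-_; 0ℤ)
  open import Data.Integer.DivMod using (n%ℕd<d)
  open import Data.Fin.Base using (Fin; toℕ; fromℕ<; remQuot; combine)
  import Data.Fin.Properties as Fin
  open import Data.Product using (Σ; _×_; _,_; proj₁; proj₂)
  open import Relation.Binary.PropositionalEquality
  open import Relation.Nullary using (¬_; yes; no)
  open ModularIntegers
  open TriangularLattice
  module D₁ = Displacement p a b
  module D₂ = Displacement q c d

  V : Set
  V = Fin (p * q)

  row : V → Fin p
  row u = proj₁ (remQuot {p} q u)

  ⟦_⟧₁ : V → ℤ
  ⟦ u ⟧₁ = + toℕ (row u)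

  ⟦_⟧₂ : V → ℤ
  ⟦ u ⟧₂ = + toℕ (proj₂ (remQuot {p} q u))

  infix 4 _—[_]→_
  _—[_]→_ : V → Pt → V → Set
  u —[ P ]→ v = ⟦ u ⟧₁ D₁.∼[ P ] ⟦ v ⟧₁ × ⟦ u ⟧₂ D₂.∼[ P ] ⟦ v ⟧₂

  —[O]→-refl : ∀ u → u —[ O ]→ u
  —[O]→-refl u = D₁.∼-refl ⟦ u ⟧₁ , D₂.∼-refl ⟦ u ⟧₂

  toℕ-≡-mod⇒≡ : ∀ {m} {i j : Fin m} → + toℕ i ≡ + toℕ j [mod m ] → i ≡ j
  toℕ-≡-mod⇒≡ {i = i} {j} i≡j = Fin.toℕ-injective (≡-mod⇒≡ (Fin.toℕ<n i) (Fin.toℕ<n j) i≡j)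

  —[O]→⇒≡ : ∀ {u v} → u —[ O ]→ v → u ≡ v
  —[O]→⇒≡ {u} {v} (∼₁ , ∼₂) = begin
    u                                ≡⟨ Fin.combine-remQuot {p} q u ⟨
    combine (proj₁ uᵣ) (proj₂ uᵣ)    ≡⟨ cong₂ combine (toℕ-≡-mod⇒≡ (D₁.∼-O⇒≡-mod ∼₁)) (toℕ-≡-mod⇒≡ (D₂.∼-O⇒≡-mod ∼₂)) ⟩
    combine (proj₁ vᵣ) (proj₂ vᵣ)    ≡⟨ Fin.combine-remQuot {p} q v ⟩
    v                                ∎
    where
    open ≡-Reasoning
    uᵣ = remQuot {p} q u
    vᵣ = remQuot {p} q v

  row-≢⇒≢0 : ∀ {u v} → row u ≢ row v → ¬ (⟦ v ⟧₁ - ⟦ u ⟧₁ ≡ 0ℤ [mod p ])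
  row-≢⇒≢0 rows≢ v-u≡0 = rows≢ (toℕ-≡-mod⇒≡ (≡-mod-sym (x-y≡0⇒x≡y v-u≡0)))

  —[]→-⊕ : ∀ {u v w} P Q → u —[ P ]→ v → v —[ Q ]→ w → u —[ P ⊕ Q ]→ w
  —[]→-⊕ P Q (∼₁ , ∼₂) (∼₁′ , ∼₂′) = D₁.∼-⊕ P Q ∼₁ ∼₁′ , D₂.∼-⊕ P Q ∼₂ ∼₂′

  —[]→-⊖ : ∀ {u v} P → u —[ P ]→ v → v —[ ⊖ P ]→ u
  —[]→-⊖ P (∼₁ , ∼₂) = D₁.∼-⊖ P ∼₁ , D₂.∼-⊖ P ∼₂

  —[]→-cancel : ∀ {u v w} P Q → u —[ P ⊕ Q ]→ w → u —[ P ]→ v → v —[ Q ]→ w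
  —[]→-cancel P Q (∼₁ , ∼₂) (∼₁′ , ∼₂′) = D₁.∼-cancel P Q ∼₁ ∼₁′ , D₂.∼-cancel P Q ∼₂ ∼₂′

  ⟦combine⟧₁ : ∀ (i : Fin p) (j : Fin q) → ⟦ combine i j ⟧₁ ≡ + toℕ i
  ⟦combine⟧₁ i j = cong (λ ij → + toℕ (proj₁ ij)) (Fin.remQuot-combine i j)

  ⟦combine⟧₂ : ∀ (i : Fin p) (j : Fin q) → ⟦ combine i j ⟧₂ ≡ + toℕ j
  ⟦combine⟧₂ i j = cong (λ ij → + toℕ (proj₂ ij)) (Fin.remQuot-combine i j)

  —[]→-target : ∀ u P → Σ V (u —[ P ]→_)
  —[]→-target u P = combine (fromℕ< r₁<p) (fromℕ< r₂<q) ,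
    subst (⟦ u ⟧₁ D₁.∼[ P ]_) (sym (trans (⟦combine⟧₁ _ _) (cong +_ (Fin.toℕ-fromℕ< r₁<p)))) (D₁.∼-%ℕ ⟦ u ⟧₁ P) ,
    subst (⟦ u ⟧₂ D₂.∼[ P ]_) (sym (trans (⟦combine⟧₂ _ _) (cong +_ (Fin.toℕ-fromℕ< r₂<q)))) (D₂.∼-%ℕ ⟦ u ⟧₂ P)
    where
    r₁<p = n%ℕd<d (⟦ u ⟧₁ + lin a b P) p
    r₂<q = n%ℕd<d (⟦ u ⟧₂ + lin c d P) q

  Step : ℕ → V → V → Set
  Step h u v = u ≢ v × Σ Pt λ P → P ∈⬡ h × u —[ P ]→ v

  Cay : ℕ → Graph
  Cay h = record
    { n      = p * q
    ; Adj    = Step h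
    ; sym    = λ { (u≢v , P , P∈⬡ , u→v) → ≢-sym u≢v , ⊖ P , ⊖-∈⬡ P P∈⬡ , —[]→-⊖ P u→v }
    ; irrefl = λ { (u≢u , _) → u≢u refl }
    }

  walk⇒—[]→ : ∀ {h m u v} → Walk (Cay h) m u v → Σ Pt λ P → P ∈⬡ m * h × u —[ P ]→ v
  walk⇒—[]→ {h} {u = u} here = O , O∈⬡ (0 * h) , —[O]→-refl u
  walk⇒—[]→ (step (_ , P , P∈⬡ , u→w) w⇝v) with walk⇒—[]→ w⇝v
  ... | Q , Q∈⬡ , w→v = P ⊕ Q , ⊕-∈⬡ P Q P∈⬡ Q∈⬡ , —[]→-⊕ P Q u→w w→v

  Sum⬡⇒DistLe : ∀ {h j P u v} → Sum⬡ h j P → u —[ P ]→ v → DistLe (Cay h) j u v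
  Sum⬡⇒DistLe [] u→v = 0 , z≤n , subst (Walk _ 0 _) (—[O]→⇒≡ u→v) here
  Sum⬡⇒DistLe {u = u} (_∷_ {Q = Q} {P = P} Q∈⬡ steps) u→v with —[]→-target u Q
  ... | w , u→w with Sum⬡⇒DistLe steps (—[]→-cancel Q P u→v u→w) | u Fin.≟ w
  ...   | m , m≤j , w⇝v | yes refl = m , m≤n⇒m≤1+n m≤j , w⇝v
  ...   | m , m≤j , w⇝v | no u≢w   = suc m , s≤s m≤j , step (u≢w , Q , Q∈⬡ , u→w) w⇝v

module HexagonResidues (R : ℕ) where
  open import Data.Nat.Base as ℕ using (zero; suc; _<_; _≤_; z≤n; s≤s)
  import Data.Nat.Properties as ℕ
  import Data.Nat.Divisibility as ℕ
  open import Data.Nat.DivMod using (_%_; _/_; m%n<n; m≡m%n+[m/n]*n; m<n*o⇒m/o<n)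
  open import Data.Integer.Base using (+_; -_; _+_; _-_; _*_; ∣_∣; 0ℤ; 1ℤ; -1ℤ)
  open import Data.Integer.Properties
    using (abs-*; ∣-i∣≡∣i∣; ∣i+j∣≤∣i∣+∣j∣; ∣i∣≡0⇒i≡0; pos-+; pos-*; *-identityˡ; +-identityˡ; +-identityʳ; *-zeroʳ;
           m-n≡m⊖n; ⊖-≥)
  open import Data.Integer.Divisibility.Signed using (_∣_; divides; ∣ᵤ⇒∣)
  open import Data.Integer.Tactic.RingSolver using (solve-∀)
  import Data.Nat.Tactic.RingSolver as ℕ-Solver
  open import Data.Integer.DivMod using (_%ℕ_; n%ℕd<d)
  open import Data.Product using (Σ; _×_; _,_)
  open import Relation.Binary.PropositionalEquality
  open import Relation.Nullary using (¬_; yes; no; contradiction)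
  open ModularIntegers
  open TriangularLattice

  ρ : ℕ
  ρ = suc (R ℕ.* R ℕ.+ R)

  φ : Pt → ℤ
  φ = lin 1ℤ (- + R)

  -- ψ is chosen so that the vectors K₂ = (-R, -1) and K₃ = (-1, R + 1), which lie in the kernel of φ modulo ρ,
  -- both have ψ ≡ 1 modulo 3; for K₃ this uses 3 ∣ R(R + 1)(R + 2).
  ψ₁ ψ₂ : ℤ
  ψ₁ = - (+ 2 + + R)
  ψ₂ = + R * + R + + 2 * + R - 1ℤ

  ψ : Pt → ℤ
  ψ = lin ψ₁ ψ₂

  φ-⊕ : ∀ P Q → φ (P ⊕ Q) ≡ φ P + φ Q
  φ-⊕ = lin-⊕ 1ℤ (- + R)

  ψ-⊕ : ∀ P Q → ψ (P ⊕ Q) ≡ ψ P + ψ Q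
  ψ-⊕ = lin-⊕ ψ₁ ψ₂

  φ-injective-on-⬡ : ∀ {P} → P ∈⬡ R → φ P ≡ 0ℤ [mod ρ ] → P ≡ O
  φ-injective-on-⬡ {x , y} (∣x∣≤R , ∣y∣≤R , ∣x+y∣≤R) φP≡0 = cong₂ _,_ x≡0 y≡0
    where
    ∣φP∣<ρ : ∣ φ (x , y) ∣ < ρ
    ∣φP∣<ρ = ℕ.s≤s (begin
      ∣ 1ℤ * x + - + R * y ∣          ≤⟨ ∣i+j∣≤∣i∣+∣j∣ (1ℤ * x) (- + R * y) ⟩
      ∣ 1ℤ * x ∣ ℕ.+ ∣ - + R * y ∣    ≡⟨ cong₂ ℕ._+_ (cong ∣_∣ (*-identityˡ x)) (abs-* (- + R) y) ⟩
      ∣ x ∣ ℕ.+ ∣ - + R ∣ ℕ.* ∣ y ∣    ≡⟨ cong (λ r → ∣ x ∣ ℕ.+ r ℕ.* ∣ y ∣) (∣-i∣≡∣i∣ (+ R)) ⟩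
      ∣ x ∣ ℕ.+ R ℕ.* ∣ y ∣           ≤⟨ ℕ.+-mono-≤ ∣x∣≤R (ℕ.*-monoʳ-≤ R ∣y∣≤R) ⟩
      R ℕ.+ R ℕ.* R                  ≡⟨ ℕ.+-comm R (R ℕ.* R) ⟩
      R ℕ.* R ℕ.+ R                  ∎)
      where open ℕ.≤-Reasoning
    x≡Ry : x ≡ + R * y
    x≡Ry = begin
      x                              ≡⟨ split x y (+ R) ⟩
      (1ℤ * x + - + R * y) + + R * y ≡⟨ cong (_+ + R * y) (≡0-mod⇒≡0 ∣φP∣<ρ φP≡0) ⟩
      0ℤ + + R * y                   ≡⟨ +-identityˡ (+ R * y) ⟩
      + R * y                        ∎
      where
      open ≡-Reasoning
      split : ∀ x y r → x ≡ (1ℤ * x + - r * y) + r * y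
      split = solve-∀
    [1+R]∣y∣≤R : suc R ℕ.* ∣ y ∣ ≤ R
    [1+R]∣y∣≤R =
      subst (_≤ R) (trans (cong ∣_∣ (trans (cong (_+ y) x≡Ry) (factor (+ R) y))) (abs-* (+ suc R) y)) ∣x+y∣≤R
      where
      factor : ∀ r y → r * y + y ≡ (1ℤ + r) * y
      factor = solve-∀
    y≡0 : y ≡ 0ℤ
    y≡0 = ∣i∣≡0⇒i≡0 (ℕ.n<1⇒n≡0 (ℕ.*-cancelˡ-< (suc R) ∣ y ∣ 1
            (ℕ.≤-<-trans [1+R]∣y∣≤R (subst (R <_) (sym (ℕ.*-identityʳ (suc R))) (ℕ.n<1+n R)))))
    x≡0 : x ≡ 0ℤ
    x≡0 = trans x≡Ry (trans (cong (+ R *_) y≡0) (*-zeroʳ (+ R)))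

  +ρ : + ρ ≡ 1ℤ + (+ R * + R + + R)
  +ρ = trans (pos-+ 1 (R ℕ.* R ℕ.+ R)) (cong (_+_ 1ℤ) (trans (pos-+ (R ℕ.* R) R) (cong (_+ + R) (pos-* R R))))

  3∣n[1+n][2+n] : ∀ n → 3 ℕ.∣ n ℕ.* (1 ℕ.+ n) ℕ.* (2 ℕ.+ n)
  3∣n[1+n][2+n] zero    = ℕ.divides 0 refl
  3∣n[1+n][2+n] (suc n) =
    subst (3 ℕ.∣_) (step n) (ℕ.∣m∣n⇒∣m+n (3∣n[1+n][2+n] n) (ℕ.n∣m*n ((1 ℕ.+ n) ℕ.* (2 ℕ.+ n))))
    where
    step : ∀ n → n ℕ.* (1 ℕ.+ n) ℕ.* (2 ℕ.+ n) ℕ.+ (1 ℕ.+ n) ℕ.* (2 ℕ.+ n) ℕ.* 3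
               ≡ (1 ℕ.+ n) ℕ.* (2 ℕ.+ n) ℕ.* (3 ℕ.+ n)
    step = ℕ-Solver.solve-∀

  P₁ : ℕ → ℕ → Pt
  P₁ X Y = + suc X , - + Y

  K₂ K₃ : Pt
  K₂ = - + R , -1ℤ
  K₃ = -1ℤ , + suc R

  φ-K₂ : φ K₂ ≡ 0ℤ [mod ρ ]
  φ-K₂ = ≡-mod-reflexive (ring (+ R))
    where
    ring : ∀ r → 1ℤ * - r + - r * -1ℤ ≡ 0ℤ
    ring = solve-∀

  φ-K₃ : φ K₃ ≡ 0ℤ [mod ρ ]
  φ-K₃ = ≡-mod-resp (trans (cong -_ +ρ) (ring (+ R))) refl (-m≡0-mod ρ)
    where
    ring : ∀ r → - (1ℤ + (r * r + r)) ≡ 1ℤ * -1ℤ + - r * (1ℤ + r)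
    ring = solve-∀

  ψ-K₂ : ψ K₂ ≡ 1ℤ [mod 3 ]
  ψ-K₂ = ≡-mod-reflexive (ring (+ R))
    where
    ring : ∀ r → - (+ 2 + r) * - r + (r * r + + 2 * r - 1ℤ) * -1ℤ ≡ 1ℤ
    ring = solve-∀

  ψ-K₃ : ψ K₃ ≡ 1ℤ [mod 3 ]
  ψ-K₃ = ≡-mod (subst (+ 3 ∣_) (sym ψK₃-1) (∣ᵤ⇒∣ (3∣n[1+n][2+n] R)))
    where
    ring : ∀ r → - (+ 2 + r) * -1ℤ + (r * r + + 2 * r - 1ℤ) * (1ℤ + r) - 1ℤ ≡ r * (1ℤ + r) * (+ 2 + r)
    ring = solve-∀
    ψK₃-1 : ψ K₃ - 1ℤ ≡ + (R ℕ.* (1 ℕ.+ R) ℕ.* (2 ℕ.+ R))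
    ψK₃-1 = trans (ring (+ R))
      (sym (trans (pos-* (R ℕ.* (1 ℕ.+ R)) (2 ℕ.+ R)) (cong (_* + (2 ℕ.+ R)) (pos-* R (1 ℕ.+ R)))))

  pos-∸ : ∀ {m n} → n ≤ m → + (m ℕ.∸ n) ≡ + m - + n
  pos-∸ {m} {n} n≤m = sym (trans (m-n≡m⊖n m n) (⊖-≥ n≤m))

  S₁ S₂ S₃ S₄ : Sector
  S₁ = sector (1ℤ , 0ℤ) (0ℤ , -1ℤ) (ℕ.≤-refl , z≤n , ℕ.≤-refl) (z≤n , ℕ.≤-refl , ℕ.≤-refl) (ℕ.≤-refl , ℕ.≤-refl , z≤n)
  S₂ = sector (-1ℤ , 0ℤ) (0ℤ , 1ℤ) (ℕ.≤-refl , z≤n , ℕ.≤-refl) (z≤n , ℕ.≤-refl , ℕ.≤-refl) (ℕ.≤-refl , ℕ.≤-refl , z≤n)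
  S₃ = sector (-1ℤ , 1ℤ) (0ℤ , -1ℤ) (ℕ.≤-refl , ℕ.≤-refl , z≤n) (z≤n , ℕ.≤-refl , ℕ.≤-refl) (ℕ.≤-refl , z≤n , ℕ.≤-refl)
  S₄ = sector (1ℤ , -1ℤ) (0ℤ , 1ℤ) (ℕ.≤-refl , ℕ.≤-refl , z≤n) (z≤n , ℕ.≤-refl , ℕ.≤-refl) (ℕ.≤-refl , z≤n , ℕ.≤-refl)

  P₁-conic : ∀ {X Y} → X < R → Y ≤ R → Conic R (P₁ X Y ⊕ O)
  P₁-conic {X} {Y} X<R Y≤R =
    conic S₁ (suc X) Y X<R Y≤R (cong₂ _,_ (ring₁ (+ suc X) (+ Y)) (ring₂ (+ suc X) (+ Y)))
    where
    ring₁ : ∀ x y → x * 1ℤ + y * 0ℤ ≡ x + 0ℤ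
    ring₁ = solve-∀
    ring₂ : ∀ x y → x * 0ℤ + y * -1ℤ ≡ - y + 0ℤ
    ring₂ = solve-∀

  P₁⊕K₂-conic : ∀ {X Y} → X < R → Y ≤ X → Conic R (P₁ X Y ⊕ K₂)
  P₁⊕K₂-conic {X} {Y} X<R Y≤X = conic S₃ α (α ℕ.+ suc Y) (ℕ.m∸n≤m R (suc X)) β≤R
    (trans (point-≡ S₃ (pos-∸ X<R) (trans (pos-+ α (suc Y)) (cong (_+ + suc Y) (pos-∸ X<R))))
           (cong₂ _,_ (ring₁ (+ R) (+ suc X) (+ Y)) (ring₂ (+ R) (+ X) (+ Y))))
    where
    α = R ℕ.∸ suc X
    β≤R : α ℕ.+ suc Y ≤ R
    β≤R = ℕ.≤-trans (ℕ.+-monoʳ-≤ α (s≤s Y≤X)) (ℕ.≤-reflexive (ℕ.m∸n+n≡m X<R))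
    ring₁ : ∀ r x y → (r - x) * -1ℤ + ((r - x) + (1ℤ + y)) * 0ℤ ≡ x + - r
    ring₁ = solve-∀
    ring₂ : ∀ r x y → (r - (1ℤ + x)) * 1ℤ + ((r - (1ℤ + x)) + (1ℤ + y)) * -1ℤ ≡ - y + -1ℤ
    ring₂ = solve-∀

  P₁⊕K₃-conic : ∀ {X Y} → Y ≤ R → X < Y → Conic R (P₁ X Y ⊕ K₃)
  P₁⊕K₃-conic {X} {Y} Y≤R X<Y = conic S₄ X (R ℕ.∸ Y ℕ.+ suc X) (ℕ.<⇒≤ (ℕ.<-≤-trans X<Y Y≤R)) β≤R
    (trans (point-≡ S₄ {α = X} refl (trans (pos-+ (R ℕ.∸ Y) (suc X)) (cong (_+ + suc X) (pos-∸ Y≤R))))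
           (cong₂ _,_ (ring₁ (+ R) (+ X) (+ Y)) (ring₂ (+ R) (+ X) (+ Y))))
    where
    β≤R : R ℕ.∸ Y ℕ.+ suc X ≤ R
    β≤R = ℕ.≤-trans (ℕ.+-monoʳ-≤ (R ℕ.∸ Y) X<Y) (ℕ.≤-reflexive (ℕ.m∸n+n≡m Y≤R))
    ring₁ : ∀ r x y → x * 1ℤ + ((r - y) + (1ℤ + x)) * 0ℤ ≡ (1ℤ + x) + -1ℤ
    ring₁ = solve-∀
    ring₂ : ∀ r x y → x * -1ℤ + ((r - y) + (1ℤ + x)) * 1ℤ ≡ - y + (1ℤ + r)
    ring₂ = solve-∀

  P₁⊕K₂⊕K₃-conic : ∀ {X Y} → X < R → Y ≤ R → Conic R (P₁ X Y ⊕ (K₂ ⊕ K₃))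
  P₁⊕K₂⊕K₃-conic {X} {Y} X<R Y≤R = conic S₂ (R ℕ.∸ X) (R ℕ.∸ Y) (ℕ.m∸n≤m R X) (ℕ.m∸n≤m R Y)
    (trans (point-≡ S₂ (pos-∸ (ℕ.<⇒≤ X<R)) (pos-∸ Y≤R))
           (cong₂ _,_ (ring₁ (+ R) (+ X) (+ Y)) (ring₂ (+ R) (+ X) (+ Y))))
    where
    ring₁ : ∀ r x y → (r - x) * -1ℤ + (r - y) * 0ℤ ≡ (1ℤ + x) + (- r + -1ℤ)
    ring₁ = solve-∀
    ring₂ : ∀ r x y → (r - x) * 0ℤ + (r - y) * 1ℤ ≡ - y + (-1ℤ + (1ℤ + r))
    ring₂ = solve-∀

  -- Translates of P₁ by the kernel vectors K₂, K₃, K₂ ⊕ K₃ of φ mod ρ realise every residue of ψ mod 3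
  -- without leaving the sectors of the hexagon of radius R.
  kernel-translate : ∀ {X Y} → X < R → Y ≤ R → ∀ δ → δ < 3 →
    Σ Pt λ K → φ K ≡ 0ℤ [mod ρ ] × ψ K ≡ + δ [mod 3 ] × Conic R (P₁ X Y ⊕ K)
  kernel-translate X<R Y≤R 0 _ =
    O , ≡-mod-reflexive (lin-O 1ℤ (- + R)) , ≡-mod-reflexive (lin-O ψ₁ ψ₂) ,
    P₁-conic X<R Y≤R
  kernel-translate {X} {Y} X<R Y≤R 1 _ with Y ℕ.≤? X
  ... | yes Y≤X = K₂ , φ-K₂ , ψ-K₂ , P₁⊕K₂-conic X<R Y≤X
  ... | no  Y≰X = K₃ , φ-K₃ , ψ-K₃ , P₁⊕K₃-conic Y≤R (ℕ.≰⇒> Y≰X)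
  kernel-translate X<R Y≤R 2 _ =
    K₂ ⊕ K₃ ,
    ≡-mod-resp (sym (φ-⊕ K₂ K₃)) refl (+-cong-mod φ-K₂ φ-K₃) ,
    ≡-mod-resp (sym (ψ-⊕ K₂ K₃)) refl (+-cong-mod ψ-K₂ ψ-K₃) ,
    P₁⊕K₂⊕K₃-conic X<R Y≤R
  kernel-translate _ _ (suc (suc (suc _))) (s≤s (s≤s (s≤s ())))

  φ-P₁ : ∀ d .{{_ : NonZero R}} → φ (P₁ (d % R) (d / R)) ≡ + suc d
  φ-P₁ d = begin
    1ℤ * + suc X + - + R * - + Y   ≡⟨ ring (+ R) (+ X) (+ Y) ⟩
    1ℤ + (+ X + + Y * + R)         ≡⟨ cong (λ z → 1ℤ + (+ X + z)) (pos-* Y R) ⟨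
    1ℤ + (+ X + + (Y ℕ.* R))       ≡⟨ cong (_+_ 1ℤ) (pos-+ X (Y ℕ.* R)) ⟨
    + suc (X ℕ.+ Y ℕ.* R)          ≡⟨ cong (λ z → + suc z) (m≡m%n+[m/n]*n d R) ⟨
    + suc d                        ∎
    where
    open ≡-Reasoning
    X = d % R
    Y = d / R
    ring : ∀ r x y → 1ℤ * (1ℤ + x) + - r * - y ≡ 1ℤ + (x + y * r)
    ring = solve-∀

  cover-residue : .{{_ : NonZero R}} → ∀ {D} d → D ≡ + suc d [mod ρ ] → suc d < ρ → ∀ Δ →
                  Σ Pt λ P → Conic R P × φ P ≡ D [mod ρ ] × ψ P ≡ Δ [mod 3 ]
  cover-residue {D} d D≡d d<ρ Δ = translate (kernel-translate X<R Y≤R δ (n%ℕd<d (Δ - ψ (P₁ X Y)) 3))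
    where
    X = d % R
    Y = d / R
    X<R : X < R
    X<R = m%n<n d R
    Y≤R : Y ≤ R
    Y≤R = ℕ.s≤s⁻¹ (m<n*o⇒m/o<n (subst (d <_) (ℕ.+-comm (R ℕ.* R) R) (ℕ.s≤s⁻¹ d<ρ)))
    δ = (Δ - ψ (P₁ X Y)) %ℕ 3
    translate : Σ Pt (λ K → φ K ≡ 0ℤ [mod ρ ] × ψ K ≡ + δ [mod 3 ] × Conic R (P₁ X Y ⊕ K)) →
                Σ Pt λ P → Conic R P × φ P ≡ D [mod ρ ] × ψ P ≡ Δ [mod 3 ]
    translate (K , φK≡0 , ψK≡δ , P-conic) =
      P₁ X Y ⊕ K ,
      P-conic ,
      ≡-mod-trans
        (≡-mod-resp (sym (φ-⊕ (P₁ X Y) K)) (+-identityʳ (+ suc d)) (+-cong-mod (≡-mod-reflexive (φ-P₁ d)) φK≡0))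
        (≡-mod-sym D≡d) ,
      ≡-mod-resp (sym (ψ-⊕ (P₁ X Y) K)) (cancel (ψ (P₁ X Y)) Δ)
        (+-cong-mod (≡-mod-reflexive {x = ψ (P₁ X Y)} refl)
                    (≡-mod-trans ψK≡δ (≡-mod-sym (≡-mod-%ℕ (Δ - ψ (P₁ X Y)) 3))))
      where
      cancel : ∀ p Δ → p + (Δ - p) ≡ Δ
      cancel = solve-∀

  cover : .{{_ : NonZero R}} → ∀ D Δ → ¬ (D ≡ 0ℤ [mod ρ ]) →
          Σ Pt λ P → Conic R P × φ P ≡ D [mod ρ ] × ψ P ≡ Δ [mod 3 ]
  cover D Δ D≢0 = via-residue (D %ℕ ρ) (≡-mod-%ℕ D ρ) (n%ℕd<d D ρ)
    where
    via-residue : ∀ d → D ≡ + d [mod ρ ] → d < ρ →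
                  Σ Pt λ P → Conic R P × φ P ≡ D [mod ρ ] × ψ P ≡ Δ [mod 3 ]
    via-residue zero    D≡0 _   = contradiction D≡0 D≢0
    via-residue (suc d) D≡d d<ρ = cover-residue d D≡d d<ρ Δ

module DisjointUnion where
  open import Defs hiding (sym)
  open import Data.Nat.Base using (suc; _+_; _≤_)
  open import Data.Nat.Properties using (≤-reflexive; ≤-trans)
  open import Data.Fin.Base using (Fin; splitAt; join; _↑ˡ_; _↑ʳ_; inject≤)
  import Data.Fin.Properties as Fin
  open import Data.List.Base using (List; upTo; length)
  import Data.List.Properties as List
  open import Data.List.Membership.Propositional using (_∈_)
  open import Data.List.Relation.Unary.Unique.Propositional using (Unique)
  open import Data.List.Relation.Unary.Unique.Propositional.Properties using (upTo⁺)
  open import Data.Product using (Σ; _×_; _,_; proj₁; proj₂)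
  open import Data.Sum using (inj₁; inj₂; [_,_]′)
  open import Data.Sum.Relation.Binary.Pointwise using (Pointwise; inj₁; inj₂; ⊎-symmetric)
  open import Function using (_∘_)
  open import Relation.Binary.PropositionalEquality
  open import Relation.Nullary using (¬_; yes; no; contradiction)

  Complete : ℕ → Graph
  Complete N = record { n = N ; Adj = _≢_ ; sym = ≢-sym ; irrefl = λ u≢u → u≢u refl }

  infixr 5 _⊎ᴳ_
  _⊎ᴳ_ : Graph → Graph → Graph
  G ⊎ᴳ H = record
    { n      = n G + n H
    ; Adj    = λ x y → Pointwise (Adj G) (Adj H) (splitAt (n G) x) (splitAt (n G) y)
    ; sym    = ⊎-symmetric (Graph.sym G) (Graph.sym H)
    ; irrefl = λ {x} → irreflexive (splitAt (n G) x)
    }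
    where
    irreflexive : ∀ s → ¬ Pointwise (Adj G) (Adj H) s s
    irreflexive (inj₁ u) (inj₁ u~u) = irrefl G u~u
    irreflexive (inj₂ v) (inj₂ v~v) = irrefl H v~v

  module _ (G H : Graph) where

    splitAt-injective : ∀ {x y} → splitAt (n G) x ≡ splitAt (n G) y → x ≡ y
    splitAt-injective {x} {y} eq =
      trans (sym (Fin.join-splitAt (n G) (n H) x))
            (trans (cong (join (n G) (n H)) eq) (Fin.join-splitAt (n G) (n H) y))

    walk-⊎ᴳ : ∀ {m x y} → Walk (G ⊎ᴳ H) m x y →
              Pointwise (Walk G m) (Walk H m) (splitAt (n G) x) (splitAt (n G) y)
    walk-⊎ᴳ {x = x} here = stay (splitAt (n G) x)
      where
      stay : ∀ s → Pointwise (Walk G 0) (Walk H 0) s s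
      stay (inj₁ u) = inj₁ here
      stay (inj₂ v) = inj₂ here
    walk-⊎ᴳ (step x~w w⇝y) = extend x~w (walk-⊎ᴳ w⇝y)
      where
      extend : ∀ {m s t r} → Pointwise (Adj G) (Adj H) s t → Pointwise (Walk G m) (Walk H m) t r →
               Pointwise (Walk G (suc m)) (Walk H (suc m)) s r
      extend (inj₁ u~w) (inj₁ w⇝v) = inj₁ (step u~w w⇝v)
      extend (inj₂ u~w) (inj₂ w⇝v) = inj₂ (step u~w w⇝v)

    ↑ˡ-walk : ∀ {m u v} → Walk G m u v → Walk (G ⊎ᴳ H) m (u ↑ˡ n H) (v ↑ˡ n H)
    ↑ˡ-walk here = here
    ↑ˡ-walk {u = u} (step {w = w} u~w w⇝v) =
      step (subst₂ (Pointwise (Adj G) (Adj H))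
                   (sym (Fin.splitAt-↑ˡ (n G) u (n H))) (sym (Fin.splitAt-↑ˡ (n G) w (n H))) (inj₁ u~w))
           (↑ˡ-walk w⇝v)

    ↑ʳ-adj : ∀ {u v} → Adj H u v → Adj (G ⊎ᴳ H) (n G ↑ʳ u) (n G ↑ʳ v)
    ↑ʳ-adj {u} {v} u~v =
      subst₂ (Pointwise (Adj G) (Adj H))
             (sym (Fin.splitAt-↑ʳ (n G) (n H) u)) (sym (Fin.splitAt-↑ʳ (n G) (n H) v)) (inj₂ u~v)

    colorable-⊎ᴳ : ∀ {k t} → Colorable (PowAdj G k) t → Colorable (PowAdj H k) t →
                   Colorable (PowAdj (G ⊎ᴳ H) k) t
    colorable-⊎ᴳ {k} (c , c-proper) (d , d-proper) = [ c , d ]′ ∘ splitAt (n G) , proper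
      where
      proper : Proper (PowAdj (G ⊎ᴳ H) k) ([ c , d ]′ ∘ splitAt (n G))
      proper x y (x≢y , m , m≤k , x⇝y) = split (x≢y ∘ splitAt-injective) (walk-⊎ᴳ x⇝y)
        where
        split : ∀ {s t} → s ≢ t → Pointwise (Walk G m) (Walk H m) s t → [ c , d ]′ s ≢ [ c , d ]′ t
        split {inj₁ u} {inj₁ v} s≢t (inj₁ u⇝v) = c-proper u v (s≢t ∘ cong inj₁ , m , m≤k , u⇝v)
        split {inj₂ u} {inj₂ v} s≢t (inj₂ u⇝v) = d-proper u v (s≢t ∘ cong inj₂ , m , m≤k , u⇝v)

    choosable-⊎ᴳ⇒choosableˡ : ∀ {k t} → Choosable (PowAdj (G ⊎ᴳ H) k) t → Choosable (PowAdj G k) t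
    choosable-⊎ᴳ⇒choosableˡ {k} {t} choose L L-ok = restrict (choose L′ (L′-ok ∘ splitAt (n G)))
      where
      L′ : Fin (n G + n H) → List ℕ
      L′ x = [ L , (λ _ → upTo t) ]′ (splitAt (n G) x)
      L′-ok : ∀ s → Unique ([ L , (λ _ → upTo t) ]′ s) × t ≤ length ([ L , (λ _ → upTo t) ]′ s)
      L′-ok (inj₁ u) = L-ok u
      L′-ok (inj₂ _) = upTo⁺ t , ≤-reflexive (sym (List.length-upTo t))
      L′-↑ˡ : ∀ u → L′ (u ↑ˡ n H) ≡ L u
      L′-↑ˡ u = cong [ L , (λ _ → upTo t) ]′ (Fin.splitAt-↑ˡ (n G) u (n H))
      restrict : Σ (Fin (n G + n H) → ℕ) (λ φ → (∀ x → φ x ∈ L′ x) × Proper (PowAdj (G ⊎ᴳ H) k) φ) →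
                 Σ (Fin (n G) → ℕ) (λ φ → (∀ u → φ u ∈ L u) × Proper (PowAdj G k) φ)
      restrict (φ , φ∈L′ , φ-proper) =
        φ ∘ (_↑ˡ n H) ,
        (λ u → subst (φ (u ↑ˡ n H) ∈_) (L′-↑ˡ u) (φ∈L′ (u ↑ˡ n H))) ,
        λ u v (u≢v , m , m≤k , u⇝v) →
          φ-proper (u ↑ˡ n H) (v ↑ˡ n H) (u≢v ∘ Fin.↑ˡ-injective (n H) u v , m , m≤k , ↑ˡ-walk u⇝v)

  colorable-≤ : ∀ {N} {R : Fin N → Fin N → Set} {t t′} → t ≤ t′ → Colorable R t → Colorable R t′
  colorable-≤ t≤t′ (c , c-proper) =
    (λ u → inject≤ (c u) t≤t′) ,
    λ u v u~v cu≡cv → c-proper u v u~v (Fin.inject≤-injective t≤t′ t≤t′ (c u) (c v) cu≡cv)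

  choosable-≤ : ∀ {N} {R : Fin N → Fin N → Set} {t t′} → t ≤ t′ → Choosable R t → Choosable R t′
  choosable-≤ t≤t′ choose L L-ok = choose L (λ v → proj₁ (L-ok v) , ≤-trans t≤t′ (proj₂ (L-ok v)))

  χ-⊎ᴳ-Complete : ∀ G {k N} → 1 ≤ k → Colorable (PowAdj G k) N →
                  ChromaticNumberIs (PowAdj (G ⊎ᴳ Complete N) k) N
  χ-⊎ᴳ-Complete G {k} {N} 1≤k colorable =
    colorable-⊎ᴳ G (Complete N) colorable ((λ u → u) , λ u v (u≢v , _) → u≢v) , clique
    where
    clique : ∀ t → Colorable (PowAdj (G ⊎ᴳ Complete N) k) t → N ≤ t
    clique t (c , c-proper) = Fin.injective⇒≤ {f = c ∘ (n G ↑ʳ_)} injective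
      where
      injective : ∀ {i j} → c (n G ↑ʳ i) ≡ c (n G ↑ʳ j) → i ≡ j
      injective {i} {j} ci≡cj with i Fin.≟ j
      ... | yes i≡j = i≡j
      ... | no  i≢j = contradiction ci≡cj (c-proper (n G ↑ʳ i) (n G ↑ʳ j)
                        (i≢j ∘ Fin.↑ʳ-injective (n G) i j , 1 , 1≤k , step (↑ʳ-adj G (Complete N) i≢j) here))

module MultipartiteChoosability where
  open import Defs hiding (sym)
  open import Data.Nat.Base using (suc; pred; _+_; _*_; _≤_; _<_; s≤s; NonZero)
  open import Data.Nat.Properties
  open import Data.Nat.DivMod using (_/_; _%_; m≡m%n+[m/n]*n; m%n<n; m/n*n≤m)
  open import Data.Nat.Tactic.RingSolver using (solve-∀)
  open import Data.Fin.Base using (Fin; toℕ; fromℕ<; remQuot; combine)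
  import Data.Fin.Properties as Fin
  open import Data.Fin.Patterns using (0F; 1F; 2F)
  open import Data.List.Base using (List; applyUpTo; length; _++_)
  open import Data.List.Properties using (length-applyUpTo; length-++)
  open import Data.List.Membership.Propositional using (_∈_)
  open import Data.List.Membership.Propositional.Properties using (∈-applyUpTo⁻; ∈-++⁻)
  open import Data.List.Relation.Unary.Unique.Propositional using (Unique)
  open import Data.List.Relation.Unary.Unique.Propositional.Properties using (applyUpTo⁺₁; ++⁺)
  open import Data.Product using (Σ; _×_; _,_; proj₁; proj₂)
  open import Data.Sum using (_⊎_; inj₁; inj₂)
  open import Function using (_∘_)
  open import Relation.Binary.PropositionalEquality
  open import Relation.Nullary using (¬_; yes; no; contradiction)
  open import Data.Empty using (⊥)
  open DisjointUnion using (choosable-≤)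

  interval : ℕ → ℕ → List ℕ
  interval a n = applyUpTo (a +_) n

  ∈-interval⁻ : ∀ {x} a n → x ∈ interval a n → a ≤ x × x < a + n
  ∈-interval⁻ a n x∈ with ∈-applyUpTo⁻ (a +_) x∈
  ... | i , i<n , refl = m≤m+n a i , +-monoʳ-< a i<n

  interval-unique : ∀ a n → Unique (interval a n)
  interval-unique a n = applyUpTo⁺₁ (a +_) n (λ i<j _ → <⇒≢ (+-monoʳ-< a i<j))

  palette : ℕ → Fin 3 → List ℕ
  palette b 0F = interval 0 (b + b)
  palette b 1F = interval b (b + b)
  palette b 2F = interval (b + b) b ++ interval 0 b

  palette-unique : ∀ b c → Unique (palette b c)
  palette-unique b 0F = interval-unique 0 (b + b)
  palette-unique b 1F = interval-unique b (b + b)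
  palette-unique b 2F = ++⁺ (interval-unique (b + b) b) (interval-unique 0 b) λ (x∈high , x∈low) →
    <⇒≱ (proj₂ (∈-interval⁻ 0 b x∈low)) (≤-trans (m≤m+n b b) (proj₁ (∈-interval⁻ (b + b) b x∈high)))

  length-palette : ∀ b c → length (palette b c) ≡ b + b
  length-palette b 0F = length-applyUpTo _ (b + b)
  length-palette b 1F = length-applyUpTo _ (b + b)
  length-palette b 2F = trans (length-++ (interval (b + b) b))
    (cong₂ _+_ (length-applyUpTo _ b) (length-applyUpTo _ b))

  palette-< : ∀ b c {x} → x ∈ palette b c → x < b + b + b
  palette-< b 0F x∈ = <-≤-trans (proj₂ (∈-interval⁻ 0 (b + b) x∈)) (m≤m+n (b + b) b)
  palette-< b 1F {x} x∈ = subst (x <_) (sym (+-assoc b b b)) (proj₂ (∈-interval⁻ b (b + b) x∈))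
  palette-< b 2F x∈ with ∈-++⁻ (interval (b + b) b) x∈
  ... | inj₁ x∈high = proj₂ (∈-interval⁻ (b + b) b x∈high)
  ... | inj₂ x∈low  = <-≤-trans (proj₂ (∈-interval⁻ 0 b x∈low)) (≤-trans (m≤m+n b b) (m≤m+n (b + b) b))

  no-common-colour : ∀ b {x} → x ∈ palette b 0F → x ∈ palette b 1F → x ∈ palette b 2F → ⊥
  no-common-colour b x∈₀ x∈₁ x∈₂ with ∈-++⁻ (interval (b + b) b) x∈₂
  ... | inj₁ x∈high = <⇒≱ (proj₂ (∈-interval⁻ 0 (b + b) x∈₀)) (proj₁ (∈-interval⁻ (b + b) b x∈high))
  ... | inj₂ x∈low  = <⇒≱ (proj₂ (∈-interval⁻ 0 b x∈low)) (proj₁ (∈-interval⁻ b (b + b) x∈₁))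

  third : ∀ m → Σ ℕ λ b → b + b + b < suc m × suc m ≤ b + b + b + 3
  third m = m / 3 , s≤s 3b≤m , (begin-strict
    m                      ≡⟨ m≡m%n+[m/n]*n m 3 ⟩
    m % 3 + m / 3 * 3      <⟨ +-monoˡ-< (m / 3 * 3) (m%n<n m 3) ⟩
    3 + m / 3 * 3          ≡⟨ +-comm 3 (m / 3 * 3) ⟩
    m / 3 * 3 + 3          ≡⟨ cong (_+ 3) (triple (m / 3)) ⟩
    m / 3 + m / 3 + m / 3 + 3 ∎)
    where
    open ≤-Reasoning
    triple : ∀ b → b * 3 ≡ b + b + b
    triple = solve-∀
    3b≤m : m / 3 + m / 3 + m / 3 ≤ m
    3b≤m = ≤-trans (≤-reflexive (sym (triple (m / 3)))) (m/n*n≤m m 3)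

  module _ {p} (R : Fin (p * 3) → Fin (p * 3) → Set) where

    row : Fin (p * 3) → Fin p
    row u = proj₁ (remQuot {p} 3 u)

    column : Fin (p * 3) → Fin 3
    column u = proj₂ (remQuot {p} 3 u)

    -- Two vertices of each row get distinct colours, since no colour lies in all three palettes; vertices of
    -- different rows are related, so these 2p colours are distinct and lie below 3b.
    ¬choosable : (∀ u v → row u ≢ row v → R u v) → ∀ b → b + b + b < p * 2 → ¬ Choosable R (b + b)
    ¬choosable rows-related b 3b<2p choose
      with choose (palette b ∘ column)
                  (λ u → palette-unique b (column u) , ≤-reflexive (sym (length-palette b (column u))))
    ... | φ , φ∈ , φ-proper = <⇒≱ 3b<2p (Fin.injective⇒≤ colour-injective)
      where
      φ∈′ : ∀ e c → φ (combine e c) ∈ palette b c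
      φ∈′ e c = subst (λ ec → φ (combine e c) ∈ palette b (proj₂ ec)) (Fin.remQuot-combine e c) (φ∈ (combine e c))

      second : Fin p → Fin 3
      second e with φ (combine e 0F) ≟ φ (combine e 1F)
      ... | yes _ = 2F
      ... | no  _ = 1F

      second-differs : ∀ e → φ (combine e 0F) ≢ φ (combine e (second e))
      second-differs e with φ (combine e 0F) ≟ φ (combine e 1F)
      ... | yes c₀≡c₁ = λ c₀≡c₂ → no-common-colour b (φ∈′ e 0F)
                          (subst (_∈ palette b 1F) (sym c₀≡c₁) (φ∈′ e 1F))
                          (subst (_∈ palette b 2F) (sym c₀≡c₂) (φ∈′ e 2F))
      ... | no  c₀≢c₁ = c₀≢c₁

      choice : Fin p → Fin 2 → Fin 3
      choice e 0F = 0F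
      choice e 1F = second e

      chosen : Fin p → Fin 2 → Fin (p * 3)
      chosen e j = combine e (choice e j)

      same-row : ∀ e j j′ → j ≢ j′ → φ (chosen e j) ≢ φ (chosen e j′)
      same-row e 0F 0F j≢j′ = contradiction refl j≢j′
      same-row e 0F 1F _    = second-differs e
      same-row e 1F 0F _    = second-differs e ∘ sym
      same-row e 1F 1F j≢j′ = contradiction refl j≢j′

      chosen-differ : ∀ e j e′ j′ → (e , j) ≢ (e′ , j′) → φ (chosen e j) ≢ φ (chosen e′ j′)
      chosen-differ e j e′ j′ ej≢e′j′ with e Fin.≟ e′
      ... | yes refl = same-row e j j′ (ej≢e′j′ ∘ cong (e ,_))
      ... | no  e≢e′ = φ-proper (chosen e j) (chosen e′ j′) (rows-related _ _ λ rows≡ →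
                         e≢e′ (trans (sym (row-combine e j)) (trans rows≡ (row-combine e′ j′))))
        where
        row-combine : ∀ e j → row (chosen e j) ≡ e
        row-combine e j = cong proj₁ (Fin.remQuot-combine e (choice e j))

      pick : Fin (p * 2) → Fin (p * 3)
      pick i = chosen (proj₁ (remQuot {p} 2 i)) (proj₂ (remQuot {p} 2 i))

      colour : Fin (p * 2) → Fin (b + b + b)
      colour i = fromℕ< (palette-< b (choice e j) (φ∈′ e (choice e j)))
        where
        e = proj₁ (remQuot {p} 2 i)
        j = proj₂ (remQuot {p} 2 i)

      colour-injective : ∀ {i i′} → colour i ≡ colour i′ → i ≡ i′
      colour-injective {i} {i′} colours≡ with i Fin.≟ i′
      ... | yes i≡i′ = i≡i′
      ... | no  i≢i′ = contradiction φ≡ (chosen-differ _ _ _ _ λ ej≡ →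
                         i≢i′ (trans (sym (Fin.combine-remQuot {p} 2 i))
                                     (trans (cong (λ (e , j) → combine e j) ej≡) (Fin.combine-remQuot {p} 2 i′))))
        where
        φ≡ : φ (pick i) ≡ φ (pick i′)
        φ≡ = trans (sym (Fin.toℕ-fromℕ< _)) (trans (cong toℕ colours≡) (Fin.toℕ-fromℕ< _))

    -- With b maximal such that 3b < 2p, choosability forces t ≥ 2b + 1, and 2p ≤ 3b + 3.
    choosable⇒ : (∀ u v → row u ≢ row v → R u v) → .{{_ : NonZero p}} →
                 ∀ t → Choosable R t → p * 4 ≤ t * 3 + 3
    choosable⇒ rows-related t choose = bound (third (pred (p * 2)))
      where
      instance _ = m*n≢0 p 2
      bound : Σ ℕ (λ b → b + b + b < suc (pred (p * 2)) × suc (pred (p * 2)) ≤ b + b + b + 3) →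
              p * 4 ≤ t * 3 + 3
      bound (b , 3b<2p , 2p≤3b+3) = by-size (≤-<-connex t (b + b))
        where
        2p≤ : p * 2 ≤ b + b + b + 3
        2p≤ = subst (_≤ b + b + b + 3) (suc-pred (p * 2)) 2p≤3b+3
        double : ∀ p → p * 4 ≡ p * 2 + p * 2
        double = solve-∀
        regroup : ∀ b → (b + b + b + 3) + (b + b + b + 3) ≡ (1 + (b + b)) * 3 + 3
        regroup = solve-∀
        by-size : t ≤ b + b ⊎ b + b < t → p * 4 ≤ t * 3 + 3
        by-size (inj₁ t≤2b) = contradiction (choosable-≤ t≤2b choose)
                                (¬choosable rows-related b (subst (b + b + b <_) (suc-pred (p * 2)) 3b<2p))
        by-size (inj₂ 2b<t) = begin
          p * 4                                   ≡⟨ double p ⟩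
          p * 2 + p * 2                           ≤⟨ +-mono-≤ 2p≤ 2p≤ ⟩
          (b + b + b + 3) + (b + b + b + 3)       ≡⟨ regroup b ⟩
          suc (b + b) * 3 + 3                     ≤⟨ +-monoˡ-≤ 3 (*-monoˡ-≤ 3 2b<t) ⟩
          t * 3 + 3                               ∎
          where open ≤-Reasoning

module HexagonalConstruction (k h : ℕ) .{{_ : NonZero k}} .{{_ : NonZero h}} where
  open import Defs hiding (sym)
  open import Data.Nat.Base using (_+_; _*_; _≤_; >-nonZero⁻¹)
  open import Data.Nat.Properties using (*-monoˡ-≤; m*n≢0)
  open import Data.Integer.Base using (+_; -_; _-_; 0ℤ; 1ℤ)
  open import Data.Fin.Base using (toℕ)
  import Data.Fin.Properties as Fin
  open import Data.Product using (Σ; _×_; _,_; proj₁; proj₂)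
  open import Function using (_∘_)
  open import Relation.Binary.PropositionalEquality
  open ModularIntegers
  open TriangularLattice
  open DisjointUnion
  open MultipartiteChoosability using (choosable⇒)

  R : ℕ
  R = k * h

  instance
    R≢0 : NonZero R
    R≢0 = m*n≢0 k h

  open HexagonResidues R
  open CayleyGraph ρ 3 1ℤ (- + R) ψ₁ ψ₂

  H : Graph
  H = Cay h

  row-proper : Proper (PowAdj H k) row
  row-proper u v (u≢v , m , m≤k , u⇝v) rows≡ = u≢v (—[O]→⇒≡ (subst (u —[_]→ v) P≡O u→v))
    where
    displacement = walk⇒—[]→ u⇝v
    P = proj₁ displacement
    u→v = proj₂ (proj₂ displacement)
    φP≡0 : φ P ≡ 0ℤ [mod ρ ]
    φP≡0 = D₁.∼-self P (subst (λ i → ⟦ u ⟧₁ D₁.∼[ P ] + toℕ i) (sym rows≡) (proj₁ u→v))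
    P≡O : P ≡ O
    P≡O = φ-injective-on-⬡ (∈⬡-mono P (*-monoˡ-≤ h m≤k) (proj₁ (proj₂ displacement))) φP≡0

  rows-adjacent : ∀ u v → row u ≢ row v → PowAdj H k u v
  rows-adjacent u v rows≢ =
    rows≢ ∘ cong row , connect (cover (⟦ v ⟧₁ - ⟦ u ⟧₁) (⟦ v ⟧₂ - ⟦ u ⟧₂) (row-≢⇒≢0 {u} {v} rows≢))
    where
    connect : (Σ Pt λ P → Conic R P × φ P ≡ ⟦ v ⟧₁ - ⟦ u ⟧₁ [mod ρ ] × ψ P ≡ ⟦ v ⟧₂ - ⟦ u ⟧₂ [mod 3 ]) →
              DistLe H k u v
    connect (P , P-conic , φP≡ , ψP≡) = Sum⬡⇒DistLe (conic⇒Sum⬡ k P-conic) (D₁.∼-mod φP≡ , D₂.∼-mod ψP≡)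

  χ-H⊎K : ∀ {N} → ρ ≤ N → ChromaticNumberIs (PowAdj (H ⊎ᴳ Complete N) k) N
  χ-H⊎K ρ≤N = χ-⊎ᴳ-Complete H (>-nonZero⁻¹ k) (colorable-≤ ρ≤N (row , row-proper))

  H⊎K-choosable⇒ : ∀ {N} t → Choosable (PowAdj (H ⊎ᴳ Complete N) k) t → ρ * 4 ≤ t * 3 + 3
  H⊎K-choosable⇒ {N} t = choosable⇒ (PowAdj H k) rows-adjacent t ∘ choosable-⊎ᴳ⇒choosableˡ H (Complete N)

module Parameters where
  open import Data.Nat.Base
  open import Data.Nat.Properties
  open import Data.Nat.Tactic.RingSolver using (solve-∀)
  open import Data.Product using (Σ; _×_; _,_)
  open import Data.Sum using (_⊎_; inj₁; inj₂)
  open import Relation.Binary.PropositionalEquality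
  open import Relation.Nullary using (contradiction)
  open HexagonResidues using (ρ)

  last-≤ : ∀ (f : ℕ → ℕ) {N} → f 0 ≤ N → ∀ m → N < f m → Σ ℕ λ h → f h ≤ N × N < f (suc h)
  last-≤ f f0≤N zero    N<f0    = contradiction f0≤N (<⇒≱ N<f0)
  last-≤ f f0≤N (suc m) N<f[1+m] = by-cases (≤-<-connex (f m) _)
    where
    by-cases : f m ≤ _ ⊎ _ < f m → Σ ℕ λ h → f h ≤ _ × _ < f (suc h)
    by-cases (inj₁ fm≤N) = m , fm≤N , N<f[1+m]
    by-cases (inj₂ N<fm) = last-≤ f f0≤N m N<fm

  ρ-suc : ∀ k h → ρ (k * suc h) ≡ ρ (k * h) + (2 * (k * h) * k + k * k + k)
  ρ-suc k h rewrite *-suc k h = expand k (k * h)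
    where
    expand : ∀ k R → suc ((k + R) * (k + R) + (k + R)) ≡ suc (R * R + R) + (2 * R * k + k * k + k)
    expand = solve-∀

  square-≤ : ∀ a b → a * a ≤ b * b → a ≤ b
  square-≤ a b a²≤b² with ≤-<-connex a b
  ... | inj₁ a≤b = a≤b
  ... | inj₂ b<a = contradiction a²≤b² (<⇒≱ (*-mono-< b<a b<a))

  ρ-increment-≤ : ∀ k R N → 576 * (k * k) ≤ N → R * R ≤ N → 6 * (2 * R * k + k * k + k) ≤ N
  ρ-increment-≤ k R N 576k²≤N R²≤N = *-cancelˡ-≤ 2 (begin
    2 * (6 * (2 * R * k + k * k + k))      ≡⟨ split k R ⟩
    24 * R * k + (12 * (k * k) + 12 * k)   ≤⟨ +-mono-≤ 24Rk≤N 12k²+12k≤N ⟩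
    N + N                                  ≡⟨ double N ⟩
    2 * N                                  ∎)
    where
    open ≤-Reasoning
    split : ∀ k R → 2 * (6 * (2 * R * k + k * k + k)) ≡ 24 * R * k + (12 * (k * k) + 12 * k)
    split = solve-∀
    double : ∀ N → N + N ≡ 2 * N
    double = solve-∀
    24Rk≤N : 24 * R * k ≤ N
    24Rk≤N = square-≤ (24 * R * k) N (begin
      24 * R * k * (24 * R * k)   ≡⟨ square k R ⟩
      576 * (k * k) * (R * R)     ≤⟨ *-mono-≤ 576k²≤N R²≤N ⟩
      N * N                       ∎)
      where
      square : ∀ k R → 24 * R * k * (24 * R * k) ≡ 576 * (k * k) * (R * R)
      square = solve-∀
    12k²+12k≤N : 12 * (k * k) + 12 * k ≤ N
    12k²+12k≤N = begin
      12 * (k * k) + 12 * k         ≤⟨ +-monoʳ-≤ (12 * (k * k)) (*-monoʳ-≤ 12 (k≤k*k k)) ⟩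
      12 * (k * k) + 12 * (k * k)   ≡⟨ add k ⟩
      24 * (k * k)                  ≤⟨ *-monoˡ-≤ (k * k) (≤ᵇ⇒≤ 24 576 _) ⟩
      576 * (k * k)                 ≤⟨ 576k²≤N ⟩
      N                             ∎
      where
      add : ∀ k → 12 * (k * k) + 12 * (k * k) ≡ 24 * (k * k)
      add = solve-∀
      k≤k*k : ∀ k → k ≤ k * k
      k≤k*k zero    = z≤n
      k≤k*k (suc k) = m≤m*n (suc k) (suc k)

  radius : ∀ k {N} .{{_ : NonZero k}} → 576 * (k * k) ≤ N →
           Σ ℕ λ h → NonZero h × ρ (k * h) ≤ N × 5 * N ≤ 6 * ρ (k * h)
  radius k {N} 576k²≤N = choose (last-≤ (λ h → ρ (k * h)) ρ[k*0]≤N N N<ρ[k*N])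
    where
    576≤N : 576 ≤ N
    576≤N = ≤-trans (m≤m*n 576 (k * k) {{m*n≢0 k k}}) 576k²≤N
    ρ[k*0]≡1 : ρ (k * 0) ≡ 1
    ρ[k*0]≡1 = cong ρ (*-zeroʳ k)
    ρ[k*0]≤N : ρ (k * 0) ≤ N
    ρ[k*0]≤N = subst (_≤ N) (sym ρ[k*0]≡1) (≤-trans (s≤s z≤n) 576≤N)
    N<ρ[k*N] : N < ρ (k * N)
    N<ρ[k*N] = s≤s (≤-trans (m≤n*m N k) (m≤n+m (k * N) (k * N * (k * N))))
    five-sixths : ∀ h → ρ (k * h) ≤ N → N < ρ (k * suc h) → 5 * N ≤ 6 * ρ (k * h)
    five-sixths h ρ≤N N<ρ′ = <⇒≤ (+-cancelʳ-< N (5 * N) (6 * ρ R) (begin-strict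
      5 * N + N                                      ≡⟨ six N ⟩
      6 * N                                          <⟨ *-monoʳ-< 6 N<ρ′ ⟩
      6 * ρ (k * suc h)                              ≡⟨ cong (6 *_) (ρ-suc k h) ⟩
      6 * (ρ R + (2 * R * k + k * k + k))            ≡⟨ *-distribˡ-+ 6 (ρ R) _ ⟩
      6 * ρ R + 6 * (2 * R * k + k * k + k)          ≤⟨ +-monoʳ-≤ (6 * ρ R) (ρ-increment-≤ k R N 576k²≤N R²≤N) ⟩
      6 * ρ R + N                                    ∎))
      where
      open ≤-Reasoning
      R = k * h
      R²≤N : R * R ≤ N
      R²≤N = ≤-trans (m≤m+n (R * R) R) (≤-trans (n≤1+n _) ρ≤N)
      six : ∀ N → 5 * N + N ≡ 6 * N
      six = solve-∀
    choose : Σ ℕ (λ h → ρ (k * h) ≤ N × N < ρ (k * suc h)) →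
             Σ ℕ λ h → NonZero h × ρ (k * h) ≤ N × 5 * N ≤ 6 * ρ (k * h)
    choose (zero  , ρ≤N , N<ρ′) = contradiction (subst (λ r → 5 * N ≤ 6 * r) ρ[k*0]≡1 (five-sixths 0 ρ≤N N<ρ′))
                                                (<⇒≱ (≤-trans (≤ᵇ⇒≤ 7 2880 _) (*-monoʳ-≤ 5 576≤N)))
    choose (suc h , ρ≤N , N<ρ′) = suc h , _ , ρ≤N , five-sixths (suc h) ρ≤N N<ρ′

  exponential-bound : ∀ j → 576 * ((3 + j) * (3 + j)) ≤ 3 ^ (8 + 3 * j)
  exponential-bound zero    = ≤ᵇ⇒≤ 5184 6561 _
  exponential-bound (suc j) = begin
    576 * ((4 + j) * (4 + j))          ≤⟨ *-monoʳ-≤ 576 square-growth ⟩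
    576 * (27 * ((3 + j) * (3 + j)))   ≡⟨ swap j ⟩
    27 * (576 * ((3 + j) * (3 + j)))   ≤⟨ *-monoʳ-≤ 27 (exponential-bound j) ⟩
    27 * 3 ^ (8 + 3 * j)               ≡⟨ cube (3 ^ (8 + 3 * j)) ⟩
    3 ^ (3 + (8 + 3 * j))              ≡⟨ cong (3 ^_) (shift j) ⟩
    3 ^ (8 + 3 * suc j)                ∎
    where
    open ≤-Reasoning
    grow : ∀ j → (4 + j) * (4 + j) + (227 + 154 * j + 26 * (j * j)) ≡ 27 * ((3 + j) * (3 + j))
    grow = solve-∀
    square-growth : (4 + j) * (4 + j) ≤ 27 * ((3 + j) * (3 + j))
    square-growth = ≤-trans (m≤m+n ((4 + j) * (4 + j)) (227 + 154 * j + 26 * (j * j))) (≤-reflexive (grow j))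
    swap : ∀ j → 576 * (27 * ((3 + j) * (3 + j))) ≡ 27 * (576 * ((3 + j) * (3 + j)))
    swap = solve-∀
    cube : ∀ x → 27 * x ≡ 3 * (3 * (3 * x))
    cube = solve-∀
    shift : ∀ j → 3 + (8 + 3 * j) ≡ 8 + 3 * suc j
    shift = solve-∀

  radius-for-3^[3sk∸1] : ∀ k s → 2 ≤ k → 1 ≤ s →
    Σ ℕ λ h → NonZero h × ρ (k * h) ≤ 3 ^ (3 * s * k ∸ 1) × 5 * 3 ^ (3 * s * k ∸ 1) ≤ 6 * ρ (k * h)
  radius-for-3^[3sk∸1] 0 _ () _
  radius-for-3^[3sk∸1] 1 _ (s≤s ()) _
  -- 576k² ≤ N fails only for k = 2, s = 1, where N = 243 and h = 7 gives ρ = 211.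
  radius-for-3^[3sk∸1] 2 1 _ _ = 7 , _ , ≤ᵇ⇒≤ 211 243 _ , ≤ᵇ⇒≤ 1215 1266 _
  radius-for-3^[3sk∸1] 2 (suc (suc s)) _ _ = radius 2 (≤-trans (≤ᵇ⇒≤ 2304 177147 _) (^-monoʳ-≤ 3 11≤e))
    where
    11≤e : 11 ≤ 3 * (2 + s) * 2 ∸ 1
    11≤e = ∸-monoˡ-≤ 1 (*-monoˡ-≤ 2 (*-monoʳ-≤ 3 (s≤s (s≤s (z≤n {s})))))
  radius-for-3^[3sk∸1] (suc (suc (suc j))) s _ 1≤s = radius (3 + j) (≤-trans (exponential-bound j) (^-monoʳ-≤ 3 e≥))
    where
    unit : ∀ j → 3 * 1 * (3 + j) ≡ 1 + (8 + 3 * j)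
    unit = solve-∀
    e≥ : 8 + 3 * j ≤ 3 * s * (3 + j) ∸ 1
    e≥ = ∸-monoˡ-≤ 1 (subst (_≤ 3 * s * (3 + j)) (unit j) (*-monoˡ-≤ (3 + j) (*-monoʳ-≤ 3 1≤s)))

  ten-ninths : ∀ N r t → 5 * N ≤ 6 * r → r * 4 ≤ t * 3 + 3 → 10 * N ≤ 9 * t + 9
  ten-ninths N r t 5N≤6r 4r≤3t+3 = begin
    10 * N            ≡⟨ double N ⟩
    2 * (5 * N)       ≤⟨ *-monoʳ-≤ 2 5N≤6r ⟩
    2 * (6 * r)       ≡⟨ regroup r ⟩
    3 * (r * 4)       ≤⟨ *-monoʳ-≤ 3 4r≤3t+3 ⟩
    3 * (t * 3 + 3)   ≡⟨ expand t ⟩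
    9 * t + 9         ∎
    where
    open ≤-Reasoning
    double : ∀ N → 10 * N ≡ 2 * (5 * N)
    double = solve-∀
    regroup : ∀ r → 2 * (6 * r) ≡ 3 * (r * 4)
    regroup = solve-∀
    expand : ∀ t → 3 * (t * 3 + 3) ≡ 9 * t + 9
    expand = solve-∀

  nine-tenths : ∀ {N} → 9 ≤ N → 9 * N ≤ 10 * N ∸ 9
  nine-tenths {N} 9≤N = begin
    9 * N               ≤⟨ m≤m+n (9 * N) (N ∸ 9) ⟩
    9 * N + (N ∸ 9)     ≡⟨ +-∸-assoc (9 * N) 9≤N ⟨
    9 * N + N ∸ 9       ≡⟨ cong (_∸ 9) (tenfold N) ⟩
    10 * N ∸ 9          ∎
    where
    open ≤-Reasoning
    tenfold : ∀ N → 9 * N + N ≡ 10 * N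
    tenfold = solve-∀

  9≤3^[3sk∸1] : ∀ k s → 2 ≤ k → 1 ≤ s → 9 ≤ 3 ^ (3 * s * k ∸ 1)
  9≤3^[3sk∸1] k s 2≤k 1≤s =
    ^-monoʳ-≤ 3 (≤-trans (s≤s (s≤s z≤n)) (∸-monoˡ-≤ 1 (*-mono-≤ (*-monoʳ-≤ 3 1≤s) 2≤k)))

open import Defs
open import Data.Nat using (ℕ; NonZero; >-nonZero; _≤_; _+_; _*_; _∸_; _^_; s≤s; z≤n)
open import Data.Nat.Properties using (≤-trans)
open import Data.Product using (Σ; _×_; _,_)
open import Function using (_∘_)
open Parameters
open HexagonResidues using (ρ)
open DisjointUnion using (_⊎ᴳ_; Complete)

theorem1 : (k s : ℕ) → 2 ≤ k → 1 ≤ s →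
    Σ Graph λ G →
      (∀ t → Choosable (PowAdj G k) t → 10 * 3 ^ (3 * s * k ∸ 1) ≤ 9 * t + 9)
      × (9 * 3 ^ (3 * s * k ∸ 1) ≤ 10 * 3 ^ (3 * s * k ∸ 1) ∸ 9)
      × ChromaticNumberIs (PowAdj G k) (3 ^ (3 * s * k ∸ 1))
theorem1 k s 2≤k 1≤s = construct (radius-for-3^[3sk∸1] k s 2≤k 1≤s)
  where
  N = 3 ^ (3 * s * k ∸ 1)
  k≢0 : NonZero k
  k≢0 = >-nonZero (≤-trans (s≤s z≤n) 2≤k)
  construct : Σ ℕ (λ h → NonZero h × ρ (k * h) ≤ N × 5 * N ≤ 6 * ρ (k * h)) →
              Σ Graph λ G → (∀ t → Choosable (PowAdj G k) t → 10 * N ≤ 9 * t + 9)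
                            × (9 * N ≤ 10 * N ∸ 9) × ChromaticNumberIs (PowAdj G k) N
  construct (h , h≢0 , ρ≤N , 5N≤6ρ) =
    H ⊎ᴳ Complete N ,
    (λ t → ten-ninths N (ρ (k * h)) t 5N≤6ρ ∘ H⊎K-choosable⇒ t) ,
    nine-tenths (9≤3^[3sk∸1] k s 2≤k 1≤s) ,
    χ-H⊎K ρ≤N
    where open HexagonalConstruction k h {{k≢0}} {{h≢0}}
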